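{- Let $4Tup := \{(a,b,c,d)^+, (a,b,c,d)^- \mid a,b,c,d \in \{0,1\}\}$. Let $\mathfrak{S}_q$ be the $(\{1,2,3,4\},\{q\})$-stit model with moments $\{\dag\}\cup 4Tup$, $\dag$ below every element of $4Tup$ (and no other strict order), histories $h_m=\{\dag,m\}$ ($m\in 4Tup$), $Choice^\dag_j = \{\{h_m : pr_j(m)=0\},\{h_m: pr_j(m)=1\}\}$ for $1\le j\le 4$, trivial choices at $m\in 4Tup$, and $V(q) = \{(\dag,h_m): (pr_1(m)=pr_2(m)=0) \vee (pr_3(m)=pr_4(m)=0) \vee sign(m)=+\}$. Let $\mathfrak{S}'_q$ be the $(\{1,2,3,4\},\{q\})$-stit model with moments $\{\ddag\}\cup 4Tup$, $\ddag$ below every element of $4Tup$, histories $g_m=\{\ddag,m\}$, $Choice'^\ddag_j = \{\{g_m : pr_j(m)=0\},\{g_m: pr_j(m)=1\}\}$, trivial choices at $m\in 4Tup$, and $V'(q) = \{(\ddag,g_m): (pr_3(m)=pr_4(m)=0)\vee(sign(m)=+ \,\&\, (pr_3(m)\neq 1 \vee pr_4(m)\neq 0))\}$. Then the relation $$B := \{(h_m, g_{m_1}) \mid m,m_1 \in 4Tup,\ ((\dag,h_m)\in V(q) \iff (\ddag,g_{m_1})\in V'(q))\}$$ is a bisimulation between $(\mathfrak{S}_q,\dag)$ and $(\mathfrak{S}'_q,\ddag)$.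
   Context: For $m = (a_1,a_2,a_3,a_4)^{s}\in 4Tup$, $pr_j(m) = a_j$ and $sign(m) = s\in\{+,-\}$. In a stit model, $H_m$ is the set of histories (maximal chains) through moment $m$ and $Choice^m_j(h)$ the cell of the partition $Choice^m_j$ of $H_m$ containing $h$; $\mathfrak{S},m,h\models q$ iff $(m,h)\in V(q)$. A relation $B\subseteq H^{\mathfrak{S}}_m\times H^{\mathfrak{S}'}_{m'}$ is a bisimulation between $(\mathfrak{S},m)$ and $(\mathfrak{S}',m')$ (for models over agents $Ag$ and variables $V$) iff its domain is all of $H^{\mathfrak{S}}_m$, its range is all of $H^{\mathfrak{S}'}_{m'}$, and for all $p\in V$, $j\in Ag$, $h_1,h_2\in H^{\mathfrak{S}}_m$, $h'_1,h'_2\in H^{\mathfrak{S}'}_{m'}$: (atoms) $h_1 B h'_1$ implies ($\mathfrak{S},m,h_1\models p$ iff $\mathfrak{S}',m',h'_1\models p$); (forth) if $h_1 B h'_1$ and $h_2\in Choice^m_j(h_1)$ then $h_2 B h'_3$ for some $h'_3\in (Choice')^{m'}_j(h'_1)$; (back) if $h_1 B h'_1$ and $h'_2\in (Choice')^{m'}_j(h'_1)$ then $h_3 B h'_2$ for some $h_3\in Choice^m_j(h_1)$. -}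

module Defs where

open import Data.Bool using (Bool; true; false)
open import Data.Fin using (Fin; zero; suc)
open import Data.Product using (_×_; ∃-syntax)
open import Data.Sum using (_⊎_)
open import Data.Unit using (⊤)
open import Relation.Binary.PropositionalEquality using (_≡_; _≢_)
open import Function.Bundles using (_⇔_)
open import Level using (0ℓ)

-- Generic pointed stit model: the histories through a fixed moment m,
-- the choice partitions at m (given as "h₂ lies in Choice^m_j(h₁)"),
-- and the valuation at m (truth of p at (m,h)).

Agent : Set
Agent = Fin 4

Var : Set
Var = ⊤

record PointedStit : Set₁ where
  field
    Hist    : Set
    InCell  : Agent → Hist → Hist → Set
    Val     : Var → Hist → Set

open PointedStit

IsBisimulation : (S S' : PointedStit) → (Hist S → Hist S' → Set) → Set
IsBisimulation S S' B =
    (∀ h → ∃[ h' ] B h h')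
  × (∀ h' → ∃[ h ] B h h')
  × (∀ (p : Var) h₁ h₁' → B h₁ h₁' → (Val S p h₁ ⇔ Val S' p h₁'))
  × (∀ (j : Agent) h₁ h₁' h₂ → B h₁ h₁' → InCell S j h₁ h₂ →
        ∃[ h₃' ] (InCell S' j h₁' h₃' × B h₂ h₃'))
  × (∀ (j : Agent) h₁ h₁' h₂' → B h₁ h₁' → InCell S' j h₁' h₂' →
        ∃[ h₃ ] (InCell S j h₁ h₃ × B h₃ h₂'))

data Sign : Set where
  plus minus : Sign

record 4Tup : Set where
  constructor tup
  field
    a₁ a₂ a₃ a₄ : Bool
    sign        : Sign

open 4Tup public

-- pr_j (agent j = 1..4 is Fin index 0..3); 0 ↦ false, 1 ↦ true
pr : Agent → 4Tup → Bool
pr zero                   m = a₁ m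
pr (suc zero)             m = a₂ m
pr (suc (suc zero))       m = a₃ m
pr (suc (suc (suc zero))) m = a₄ m

sameChoice : Agent → 4Tup → 4Tup → Set
sameChoice j m₁ m₂ = pr j m₁ ≡ pr j m₂

Vq : 4Tup → Set
Vq m = ((pr zero m ≡ false) × (pr (suc zero) m ≡ false))
     ⊎ ((pr (suc (suc zero)) m ≡ false) × (pr (suc (suc (suc zero))) m ≡ false))
     ⊎ (sign m ≡ plus)

V'q : 4Tup → Set
V'q m = ((pr (suc (suc zero)) m ≡ false) × (pr (suc (suc (suc zero))) m ≡ false))
      ⊎ ((sign m ≡ plus) × ((pr (suc (suc zero)) m ≢ true) ⊎ (pr (suc (suc (suc zero))) m ≢ false)))

S-dagger : PointedStit
S-dagger = record { Hist = 4Tup ; InCell = sameChoice ; Val = λ _ → Vq }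

S'-ddagger : PointedStit
S'-ddagger = record { Hist = 4Tup ; InCell = sameChoice ; Val = λ _ → V'q }

B : 4Tup → 4Tup → Set
B m m₁ = Vq m ⇔ V'q m₁

-- No agent's choice at † (or ‡) settles q: every cell contains both a q- and
-- a ¬q-history.  Hence a history can always be matched, inside any cell of
-- the other model, by one with the same truth value of q, so relating
-- histories exactly when they agree on q is a bisimulation.

module Submission where

open import Defs
open import Data.Bool using (Bool; true; false)
open import Data.Bool.Properties using (_≟_)
open import Data.Empty using (⊥-elim)
open import Data.Fin using (zero; suc)
open import Data.Product using (_×_; _,_; ∃-syntax; uncurry)
open import Data.Sum using (inj₁; inj₂)
open import Data.Unit using (tt)
open import Function using (_∘_; const)
open import Function.Bundles using (_⇔_; mk⇔)
open import Function.Construct.Symmetry using (⇔-sym)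
open import Relation.Binary.PropositionalEquality using (_≡_; refl; sym)
open import Relation.Nullary using (¬_; Dec; yes; no; ¬?; _×-dec_; _⊎-dec_)
open import Relation.Unary using (Decidable)

open PointedStit

Holds : (S : PointedStit) → Hist S → Set
Holds S = Val S tt

InCellWith : (S : PointedStit) → Agent → Hist S → (Hist S → Set) → Set
InCellWith S j h P = ∃[ h₂ ] (InCell S j h h₂ × P h₂)

Unsettled : PointedStit → Set
Unsettled S = ∀ j h → InCellWith S j h (Holds S) × InCellWith S j h (¬_ ∘ Holds S)

witness-equivalent : {A : Set} {C Q : A → Set} {P : Set} → Dec P →
                     ∃[ a ] (C a × Q a) → ∃[ a ] (C a × ¬ Q a) →
                     ∃[ a ] (C a × (P ⇔ Q a))
witness-equivalent (yes p) (a , c , q) _  = a , c , mk⇔ (const q) (const p)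
witness-equivalent (no ¬p) _ (a , c , ¬q) = a , c , mk⇔ (⊥-elim ∘ ¬p) (⊥-elim ∘ ¬q)

agreement-isBisimulation : (S S' : PointedStit) →
                           Decidable (Holds S) → Decidable (Holds S') →
                           Unsettled S → Unsettled S' → Hist S → Hist S' →
                           IsBisimulation S S' (λ h h' → Holds S h ⇔ Holds S' h')
agreement-isBisimulation S S' dec dec' unsettled unsettled' h₀ h₀' =
  domain , range , atoms , forth , back
  where
  agreeing-in-S' : ∀ j h' h → ∃[ h₃' ] (InCell S' j h' h₃' × (Holds S h ⇔ Holds S' h₃'))
  agreeing-in-S' j h' h = uncurry (witness-equivalent (dec h)) (unsettled' j h')

  agreeing-in-S : ∀ j h h' → ∃[ h₃ ] (InCell S j h h₃ × (Holds S h₃ ⇔ Holds S' h'))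
  agreeing-in-S j h h' with uncurry (witness-equivalent (dec' h')) (unsettled j h)
  ... | h₃ , c , e = h₃ , c , ⇔-sym e

  domain : ∀ h → ∃[ h' ] (Holds S h ⇔ Holds S' h')
  domain h with agreeing-in-S' zero h₀' h
  ... | h' , _ , e = h' , e

  range : ∀ h' → ∃[ h ] (Holds S h ⇔ Holds S' h')
  range h' with agreeing-in-S zero h₀ h'
  ... | h , _ , e = h , e

  atoms : ∀ p h h' → Holds S h ⇔ Holds S' h' → Val S p h ⇔ Val S' p h'
  atoms tt _ _ e = e

  forth : ∀ j h₁ h₁' h₂ → Holds S h₁ ⇔ Holds S' h₁' → InCell S j h₁ h₂ →
          ∃[ h₃' ] (InCell S' j h₁' h₃' × (Holds S h₂ ⇔ Holds S' h₃'))
  forth j _ h₁' h₂ _ _ = agreeing-in-S' j h₁' h₂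

  back : ∀ j h₁ h₁' h₂' → Holds S h₁ ⇔ Holds S' h₁' → InCell S' j h₁' h₂' →
         ∃[ h₃ ] (InCell S j h₁ h₃ × (Holds S h₃ ⇔ Holds S' h₂'))
  back j h₁ _ h₂' _ _ = agreeing-in-S j h₁ h₂'

update : Agent → Bool → 4Tup → 4Tup
update zero                   b (tup _ a₂ a₃ a₄ s) = tup b a₂ a₃ a₄ s
update (suc zero)             b (tup a₁ _ a₃ a₄ s) = tup a₁ b a₃ a₄ s
update (suc (suc zero))       b (tup a₁ a₂ _ a₄ s) = tup a₁ a₂ b a₄ s
update (suc (suc (suc zero))) b (tup a₁ a₂ a₃ _ s) = tup a₁ a₂ a₃ b s

pr-update : ∀ j b m → pr j (update j b m) ≡ b
pr-update zero                   b m = refl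
pr-update (suc zero)             b m = refl
pr-update (suc (suc zero))       b m = refl
pr-update (suc (suc (suc zero))) b m = refl

cellmate : (P : 4Tup → Set) (t : 4Tup) → (∀ j b → P (update j b t)) →
           ∀ j m → ∃[ m₂ ] (sameChoice j m m₂ × P m₂)
cellmate P t p j m = update j (pr j m) t , sym (pr-update j (pr j m) t) , p j (pr j m)

Vq-update-plus : ∀ j b → Vq (update j b (tup true true true true plus))
Vq-update-plus zero                   b = inj₂ (inj₂ refl)
Vq-update-plus (suc zero)             b = inj₂ (inj₂ refl)
Vq-update-plus (suc (suc zero))       b = inj₂ (inj₂ refl)
Vq-update-plus (suc (suc (suc zero))) b = inj₂ (inj₂ refl)

¬Vq-update-minus : ∀ j b → ¬ Vq (update j b (tup true true true true minus))
¬Vq-update-minus zero                   b (inj₁ (_ , ()))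
¬Vq-update-minus (suc zero)             b (inj₁ (() , _))
¬Vq-update-minus (suc (suc zero))       b (inj₁ (() , _))
¬Vq-update-minus (suc (suc (suc zero))) b (inj₁ (() , _))
¬Vq-update-minus zero                   b (inj₂ (inj₁ (() , _)))
¬Vq-update-minus (suc zero)             b (inj₂ (inj₁ (() , _)))
¬Vq-update-minus (suc (suc zero))       b (inj₂ (inj₁ (_ , ())))
¬Vq-update-minus (suc (suc (suc zero))) b (inj₂ (inj₁ (() , _)))
¬Vq-update-minus zero                   b (inj₂ (inj₂ ()))
¬Vq-update-minus (suc zero)             b (inj₂ (inj₂ ()))
¬Vq-update-minus (suc (suc zero))       b (inj₂ (inj₂ ()))
¬Vq-update-minus (suc (suc (suc zero))) b (inj₂ (inj₂ ()))

V'q-update-plus : ∀ j b → V'q (update j b (tup false false false true plus))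
V'q-update-plus zero                   b = inj₂ (refl , inj₁ λ ())
V'q-update-plus (suc zero)             b = inj₂ (refl , inj₁ λ ())
V'q-update-plus (suc (suc zero))       b = inj₂ (refl , inj₂ λ ())
V'q-update-plus (suc (suc (suc zero))) b = inj₂ (refl , inj₁ λ ())

¬V'q-update-minus : ∀ j b → ¬ V'q (update j b (tup true true true true minus))
¬V'q-update-minus zero                   b (inj₁ (() , _))
¬V'q-update-minus (suc zero)             b (inj₁ (() , _))
¬V'q-update-minus (suc (suc zero))       b (inj₁ (_ , ()))
¬V'q-update-minus (suc (suc (suc zero))) b (inj₁ (() , _))
¬V'q-update-minus zero                   b (inj₂ (() , _))
¬V'q-update-minus (suc zero)             b (inj₂ (() , _))
¬V'q-update-minus (suc (suc zero))       b (inj₂ (() , _))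
¬V'q-update-minus (suc (suc (suc zero))) b (inj₂ (() , _))

unsettled-S-dagger : Unsettled S-dagger
unsettled-S-dagger j m = cellmate Vq _ Vq-update-plus j m
                       , cellmate (¬_ ∘ Vq) _ ¬Vq-update-minus j m

unsettled-S'-ddagger : Unsettled S'-ddagger
unsettled-S'-ddagger j m = cellmate V'q _ V'q-update-plus j m
                         , cellmate (¬_ ∘ V'q) _ ¬V'q-update-minus j m

plus? : ∀ s → Dec (s ≡ plus)
plus? plus  = yes refl
plus? minus = no λ ()

Vq? : Decidable Vq
Vq? m = ((pr zero m ≟ false) ×-dec (pr (suc zero) m ≟ false))
    ⊎-dec ((pr (suc (suc zero)) m ≟ false) ×-dec (pr (suc (suc (suc zero))) m ≟ false))
    ⊎-dec plus? (sign m)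

V'q? : Decidable V'q
V'q? m = ((pr (suc (suc zero)) m ≟ false) ×-dec (pr (suc (suc (suc zero))) m ≟ false))
     ⊎-dec (plus? (sign m) ×-dec (¬? (pr (suc (suc zero)) m ≟ true)
                                  ⊎-dec ¬? (pr (suc (suc (suc zero))) m ≟ false)))

lemma14 : IsBisimulation S-dagger S'-ddagger B
lemma14 = agreement-isBisimulation S-dagger S'-ddagger Vq? V'q?
            unsettled-S-dagger unsettled-S'-ddagger m₀ m₀
  where
  m₀ : 4Tup
  m₀ = tup false false false false plus
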